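{- The Desargues graph $G(10,3)$ is a monoid graph.
   Context: $G(n,k)$ ($0<k<n/2$) has vertices $u_0,\dots,u_{n-1},v_0,\dots,v_{n-1}$ and edges $u_iu_{i+1}$, $v_iv_{i+k}$, $u_iv_i$ (indices mod $n$). For a semigroup $S$ and $C\subseteq S$, the Cayley graph $\mathrm{Cay}(S,C)$ is the directed multigraph (loops allowed) with vertex set $S$ and one arc $(s,sc)$ for each $s\in S$, $c\in C$; its underlying graph is obtained by deleting loops, forgetting orientations and merging parallel edges. A graph is a monoid graph if it is isomorphic to the underlying graph of $\mathrm{Cay}(M,C)$ for some monoid $M$ and some $C\subseteq M$. -}

module Defs where

open import Level using (0ℓ)
open import Data.Nat using (ℕ; _+_; NonZero)
open import Data.Nat.DivMod using (_%_)
open import Data.Fin using (Fin; toℕ)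
open import Data.Sum using (_⊎_)
open import Data.Product using (Σ; ∃; ∃-syntax; _×_; _,_)
open import Relation.Binary.PropositionalEquality using (_≡_)
open import Relation.Nullary using (¬_)
open import Relation.Unary using (Pred; _∈_)
open import Algebra.Structures using (IsMonoid)
open import Function.Bundles using (Bijection; _⤖_; _⇔_)

-- Vertices of G(n,k): inj₁ i is u_i, inj₂ i is v_i.
GPVertex : ℕ → Set
GPVertex n = Fin n ⊎ Fin n

data GPEdge (n k : ℕ) .{{_ : NonZero n}} : GPVertex n → GPVertex n → Set where
  uu : ∀ {i j : Fin n} → toℕ j ≡ (toℕ i + 1) % n → GPEdge n k (_⊎_.inj₁ i) (_⊎_.inj₁ j)
  vv : ∀ {i j : Fin n} → toℕ j ≡ (toℕ i + k) % n → GPEdge n k (_⊎_.inj₂ i) (_⊎_.inj₂ j)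
  uv : ∀ {i : Fin n} → GPEdge n k (_⊎_.inj₁ i) (_⊎_.inj₂ i)

GPAdj : (n k : ℕ) .{{_ : NonZero n}} → GPVertex n → GPVertex n → Set
GPAdj n k x y = GPEdge n k x y ⊎ GPEdge n k y x

-- Adjacency in the underlying graph of Cay(S, C): loops deleted,
-- orientations forgotten, parallel edges merged.
CayUAdj : {A : Set} → (A → A → A) → Pred A 0ℓ → A → A → Set
CayUAdj _∙_ C a b =
  ¬ (a ≡ b) × (∃[ c ] (c ∈ C × ((b ≡ a ∙ c) ⊎ (a ≡ b ∙ c))))

IsMonoidGraph : (V : Set) → (V → V → Set) → Set₁
IsMonoidGraph V Adj =
  Σ Set λ M → Σ (M → M → M) λ _∙_ → Σ M λ ε → IsMonoid _≡_ _∙_ ε ×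
    Σ (Pred M 0ℓ) λ C → Σ (V ⤖ M) λ φ →
      ∀ x y → Adj x y ⇔ CayUAdj _∙_ C (Bijection.to φ x) (Bijection.to φ y)

{-# OPTIONS --safe #-}
module Submission where

-- A 20-element monoid, given by its multiplication table, has G(10,3) as the underlying
-- graph of its right Cayley graph for the generators {1, 9, 10}.  The monoid laws and the
-- correspondence of adjacencies are decidable finite properties, checked by evaluation.

open import Data.Nat using (ℕ; NonZero)
open import Defs

open import Level using (Level; 0ℓ)
open import Data.Bool.Properties using () renaming (_≟_ to _≟ᵇ_)
open import Data.Nat as ℕ using (_+_; _%_)
open import Data.Fin using (Fin; #_; toℕ)
open import Data.Fin.Properties using (all?; any?; +↔⊎) renaming (_≟_ to _≟ᶠ_)
open import Data.Vec using (Vec; _∷_; []; lookup)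
open import Data.Sum using (_⊎_; inj₁; inj₂; [_,_])
open import Data.Product using (_,_)
open import Data.Empty using (⊥-elim)
open import Function using (_∘_)
open import Function.Bundles using (Bijection; _⤖_; _⇔_; mk⇔)
open import Function.Properties.Inverse using (↔-sym; ↔⇒⤖)
open import Relation.Binary.PropositionalEquality using (_≡_; refl; isEquivalence; cong₂)
open import Relation.Nullary using (Dec; yes; no; does)
open import Relation.Nullary.Decidable using (_⊎-dec_; _×-dec_; ¬?; map′; toWitness)
open import Relation.Unary using (Pred; Decidable)
open import Algebra.Core using (Op₂)
open import Algebra.Structures using (IsMonoid)

private
  variable
    a p : Level
    A B : Set a
    m n : ℕ

does-≡⇒⇔ : (a? : Dec A) (b? : Dec B) → does a? ≡ does b? → A ⇔ B
does-≡⇒⇔ (yes x) (yes y) _  = mk⇔ (λ _ → y) (λ _ → x)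
does-≡⇒⇔ (no ¬x) (no ¬y) _ = mk⇔ (⊥-elim ∘ ¬x) (⊥-elim ∘ ¬y)

all?-⊎ : {P : Pred (Fin m ⊎ Fin n) p} → Decidable P → Dec (∀ x → P x)
all?-⊎ P? = map′ (λ (p₁ , p₂) → [ p₁ , p₂ ]) (λ p → p ∘ inj₁ , p ∘ inj₂)
  (all? (P? ∘ inj₁) ×-dec all? (P? ∘ inj₂))

gpEdge? : (n k : ℕ) .{{_ : NonZero n}} (x y : GPVertex n) → Dec (GPEdge n k x y)
gpEdge? n k (inj₁ i) (inj₁ j) = map′ uu (λ { (uu e) → e }) (toℕ j ℕ.≟ (toℕ i + 1) % n)
gpEdge? n k (inj₂ i) (inj₂ j) = map′ vv (λ { (vv e) → e }) (toℕ j ℕ.≟ (toℕ i + k) % n)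
gpEdge? n k (inj₁ i) (inj₂ j) with i ≟ᶠ j
... | yes refl = yes uv
... | no i≢j   = no λ { uv → i≢j refl }
gpEdge? n k (inj₂ i) (inj₁ j) = no λ ()

gpAdj? : (n k : ℕ) .{{_ : NonZero n}} (x y : GPVertex n) → Dec (GPAdj n k x y)
gpAdj? n k x y = gpEdge? n k x y ⊎-dec gpEdge? n k y x

cayUAdj? : (_∙_ : Op₂ (Fin m)) {C : Pred (Fin m) 0ℓ} → Decidable C →
           (x y : Fin m) → Dec (CayUAdj _∙_ C x y)
cayUAdj? _∙_ C? x y =
  ¬? (x ≟ᶠ y) ×-dec any? (λ c → C? c ×-dec ((y ≟ᶠ x ∙ c) ⊎-dec (x ≟ᶠ y ∙ c)))

-- u_i is encoded as i and v_i as 10 + i.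
table : Vec (Vec (Fin 20) 20) 20
table =
  (# 0 ∷ # 1 ∷ # 2 ∷ # 3 ∷ # 4 ∷ # 5 ∷ # 6 ∷ # 7 ∷ # 8 ∷ # 9 ∷ # 10 ∷ # 11 ∷ # 12 ∷ # 13 ∷ # 14 ∷ # 15 ∷ # 16 ∷ # 17 ∷ # 18 ∷ # 19 ∷ []) ∷
  (# 1 ∷ # 0 ∷ # 9 ∷ # 8 ∷ # 7 ∷ # 6 ∷ # 5 ∷ # 4 ∷ # 3 ∷ # 2 ∷ # 11 ∷ # 10 ∷ # 19 ∷ # 18 ∷ # 17 ∷ # 16 ∷ # 15 ∷ # 14 ∷ # 13 ∷ # 12 ∷ []) ∷
  (# 2 ∷ # 2 ∷ # 2 ∷ # 3 ∷ # 2 ∷ # 2 ∷ # 2 ∷ # 2 ∷ # 3 ∷ # 2 ∷ # 3 ∷ # 3 ∷ # 2 ∷ # 3 ∷ # 2 ∷ # 3 ∷ # 3 ∷ # 2 ∷ # 3 ∷ # 2 ∷ []) ∷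
  (# 3 ∷ # 3 ∷ # 3 ∷ # 3 ∷ # 3 ∷ # 3 ∷ # 3 ∷ # 3 ∷ # 3 ∷ # 3 ∷ # 3 ∷ # 3 ∷ # 3 ∷ # 3 ∷ # 3 ∷ # 3 ∷ # 3 ∷ # 3 ∷ # 3 ∷ # 3 ∷ []) ∷
  (# 4 ∷ # 4 ∷ # 4 ∷ # 3 ∷ # 4 ∷ # 4 ∷ # 4 ∷ # 4 ∷ # 3 ∷ # 4 ∷ # 3 ∷ # 3 ∷ # 4 ∷ # 3 ∷ # 4 ∷ # 3 ∷ # 3 ∷ # 4 ∷ # 3 ∷ # 4 ∷ []) ∷
  (# 5 ∷ # 6 ∷ # 7 ∷ # 8 ∷ # 7 ∷ # 6 ∷ # 5 ∷ # 4 ∷ # 3 ∷ # 4 ∷ # 15 ∷ # 16 ∷ # 6 ∷ # 18 ∷ # 6 ∷ # 16 ∷ # 15 ∷ # 5 ∷ # 13 ∷ # 5 ∷ []) ∷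
  (# 6 ∷ # 5 ∷ # 4 ∷ # 3 ∷ # 4 ∷ # 5 ∷ # 6 ∷ # 7 ∷ # 8 ∷ # 7 ∷ # 16 ∷ # 15 ∷ # 5 ∷ # 13 ∷ # 5 ∷ # 15 ∷ # 16 ∷ # 6 ∷ # 18 ∷ # 6 ∷ []) ∷
  (# 7 ∷ # 7 ∷ # 7 ∷ # 8 ∷ # 7 ∷ # 7 ∷ # 7 ∷ # 7 ∷ # 8 ∷ # 7 ∷ # 8 ∷ # 8 ∷ # 7 ∷ # 8 ∷ # 7 ∷ # 8 ∷ # 8 ∷ # 7 ∷ # 8 ∷ # 7 ∷ []) ∷
  (# 8 ∷ # 8 ∷ # 8 ∷ # 8 ∷ # 8 ∷ # 8 ∷ # 8 ∷ # 8 ∷ # 8 ∷ # 8 ∷ # 8 ∷ # 8 ∷ # 8 ∷ # 8 ∷ # 8 ∷ # 8 ∷ # 8 ∷ # 8 ∷ # 8 ∷ # 8 ∷ []) ∷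
  (# 9 ∷ # 9 ∷ # 9 ∷ # 8 ∷ # 9 ∷ # 9 ∷ # 9 ∷ # 9 ∷ # 8 ∷ # 9 ∷ # 8 ∷ # 8 ∷ # 9 ∷ # 8 ∷ # 9 ∷ # 8 ∷ # 8 ∷ # 9 ∷ # 8 ∷ # 9 ∷ []) ∷
  (# 10 ∷ # 10 ∷ # 13 ∷ # 3 ∷ # 13 ∷ # 10 ∷ # 10 ∷ # 13 ∷ # 3 ∷ # 13 ∷ # 10 ∷ # 10 ∷ # 10 ∷ # 13 ∷ # 10 ∷ # 10 ∷ # 10 ∷ # 10 ∷ # 13 ∷ # 10 ∷ []) ∷
  (# 11 ∷ # 11 ∷ # 18 ∷ # 8 ∷ # 18 ∷ # 11 ∷ # 11 ∷ # 18 ∷ # 8 ∷ # 18 ∷ # 11 ∷ # 11 ∷ # 11 ∷ # 18 ∷ # 11 ∷ # 11 ∷ # 11 ∷ # 11 ∷ # 18 ∷ # 11 ∷ []) ∷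
  (# 12 ∷ # 19 ∷ # 9 ∷ # 8 ∷ # 7 ∷ # 6 ∷ # 5 ∷ # 4 ∷ # 3 ∷ # 2 ∷ # 15 ∷ # 16 ∷ # 19 ∷ # 18 ∷ # 6 ∷ # 16 ∷ # 15 ∷ # 5 ∷ # 13 ∷ # 12 ∷ []) ∷
  (# 13 ∷ # 13 ∷ # 13 ∷ # 3 ∷ # 13 ∷ # 13 ∷ # 13 ∷ # 13 ∷ # 3 ∷ # 13 ∷ # 3 ∷ # 3 ∷ # 13 ∷ # 3 ∷ # 13 ∷ # 3 ∷ # 3 ∷ # 13 ∷ # 3 ∷ # 13 ∷ []) ∷
  (# 14 ∷ # 17 ∷ # 7 ∷ # 8 ∷ # 7 ∷ # 6 ∷ # 5 ∷ # 4 ∷ # 3 ∷ # 4 ∷ # 11 ∷ # 10 ∷ # 6 ∷ # 18 ∷ # 17 ∷ # 16 ∷ # 15 ∷ # 14 ∷ # 13 ∷ # 5 ∷ []) ∷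
  (# 15 ∷ # 15 ∷ # 18 ∷ # 8 ∷ # 18 ∷ # 15 ∷ # 15 ∷ # 18 ∷ # 8 ∷ # 18 ∷ # 15 ∷ # 15 ∷ # 15 ∷ # 18 ∷ # 15 ∷ # 15 ∷ # 15 ∷ # 15 ∷ # 18 ∷ # 15 ∷ []) ∷
  (# 16 ∷ # 16 ∷ # 13 ∷ # 3 ∷ # 13 ∷ # 16 ∷ # 16 ∷ # 13 ∷ # 3 ∷ # 13 ∷ # 16 ∷ # 16 ∷ # 16 ∷ # 13 ∷ # 16 ∷ # 16 ∷ # 16 ∷ # 16 ∷ # 13 ∷ # 16 ∷ []) ∷
  (# 17 ∷ # 14 ∷ # 4 ∷ # 3 ∷ # 4 ∷ # 5 ∷ # 6 ∷ # 7 ∷ # 8 ∷ # 7 ∷ # 10 ∷ # 11 ∷ # 5 ∷ # 13 ∷ # 14 ∷ # 15 ∷ # 16 ∷ # 17 ∷ # 18 ∷ # 6 ∷ []) ∷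
  (# 18 ∷ # 18 ∷ # 18 ∷ # 8 ∷ # 18 ∷ # 18 ∷ # 18 ∷ # 18 ∷ # 8 ∷ # 18 ∷ # 8 ∷ # 8 ∷ # 18 ∷ # 8 ∷ # 18 ∷ # 8 ∷ # 8 ∷ # 18 ∷ # 8 ∷ # 18 ∷ []) ∷
  (# 19 ∷ # 12 ∷ # 2 ∷ # 3 ∷ # 4 ∷ # 5 ∷ # 6 ∷ # 7 ∷ # 8 ∷ # 9 ∷ # 16 ∷ # 15 ∷ # 12 ∷ # 13 ∷ # 5 ∷ # 15 ∷ # 16 ∷ # 6 ∷ # 18 ∷ # 19 ∷ []) ∷ []

infixl 7 _∙_

_∙_ : Op₂ (Fin 20)
i ∙ j = lookup (lookup table i) j

generator : Pred (Fin 20) 0ℓ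
generator c = c ≡ # 1 ⊎ c ≡ # 9 ⊎ c ≡ # 10

generator? : Decidable generator
generator? c = (c ≟ᶠ # 1) ⊎-dec (c ≟ᶠ # 9) ⊎-dec (c ≟ᶠ # 10)

∙-assoc : ∀ i j k → (i ∙ j) ∙ k ≡ i ∙ (j ∙ k)
∙-assoc = toWitness {a? = all? λ i → all? λ j → all? λ k → (i ∙ j) ∙ k ≟ᶠ i ∙ (j ∙ k)} _

∙-identityˡ : ∀ i → # 0 ∙ i ≡ i
∙-identityˡ = toWitness {a? = all? λ i → # 0 ∙ i ≟ᶠ i} _

∙-identityʳ : ∀ i → i ∙ # 0 ≡ i
∙-identityʳ = toWitness {a? = all? λ i → i ∙ # 0 ≟ᶠ i} _

∙-isMonoid : IsMonoid _≡_ _∙_ (# 0)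
∙-isMonoid = record
  { isSemigroup = record
    { isMagma = record { isEquivalence = isEquivalence ; ∙-cong = cong₂ _∙_ }
    ; assoc   = ∙-assoc
    }
  ; identity = ∙-identityˡ , ∙-identityʳ
  }

encode : GPVertex 10 ⤖ Fin 20
encode = ↔⇒⤖ (↔-sym +↔⊎)

open Bijection encode using (to)

desargues≅cayley : ∀ x y → GPAdj 10 3 x y ⇔ CayUAdj _∙_ generator (to x) (to y)
desargues≅cayley x y = does-≡⇒⇔ (gpAdj? 10 3 x y) (cayley? x y) (agreement x y)
  where
  cayley? : ∀ x y → Dec (CayUAdj _∙_ generator (to x) (to y))
  cayley? x y = cayUAdj? _∙_ generator? (to x) (to y)
  agreement : ∀ x y → does (gpAdj? 10 3 x y) ≡ does (cayley? x y)
  agreement = toWitness {a? = all?-⊎ λ x → all?-⊎ λ y → does (gpAdj? 10 3 x y) ≟ᵇ does (cayley? x y)} _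

proposition3p8 : IsMonoidGraph (GPVertex 10) (GPAdj 10 3)
proposition3p8 = Fin 20 , _∙_ , # 0 , ∙-isMonoid , generator , encode , desargues≅cayley
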